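{- Let $k\ge 1$ be an integer and let $G$ be a graph with minimum degree $\delta(G)\ge k$. Then $G$ has a total $k$-coalition partition.
   Context: All graphs are finite, simple and connected. For a vertex $v$, $N(v)$ denotes its open neighborhood. For a graph $G$ with $\delta(G)\ge k$, a set $S\subseteq V(G)$ is a total $k$-dominating set if $|N(v)\cap S|\ge k$ for every $v\in V(G)$. Two disjoint sets $U,W\subseteq V(G)$ form a total $k$-coalition if neither $U$ nor $W$ is a total $k$-dominating set but $U\cup W$ is a total $k$-dominating set. A total $k$-coalition partition of $G$ is a partition $\Omega=\{V_1,\dots,V_{|\Omega|}\}$ of $V(G)$ such that every $V_i$ forms a total $k$-coalition with some other $V_j\in\Omega$. -}

module Defs where

open import Data.Nat using (ℕ; zero; suc; _≤_)
open import Data.Bool using (Bool; true; false)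
open import Data.Fin using (Fin)
open import Data.Fin.Subset using (Subset; ∣_∣; _∩_; _∪_; _∈_)
open import Data.Vec using (tabulate)
open import Data.Product using (Σ; _×_; ∃-syntax)
open import Relation.Nullary using (¬_)
open import Relation.Binary.PropositionalEquality using (_≡_; _≢_)
open import Relation.Nullary.Decidable using (⌊_⌋)
open import Data.Fin using (_≟_)

record Graph : Set where
  field
    n    : ℕ
    adj  : Fin n → Fin n → Bool
    sym  : ∀ u v → adj u v ≡ adj v u
    irr  : ∀ v → adj v v ≡ false

open Graph public

data Reach (G : Graph) : Fin (n G) → Fin (n G) → Set where
  here : ∀ {v} → Reach G v v
  step : ∀ {u w v} → adj G u w ≡ true → Reach G w v → Reach G u v

Connected : Graph → Set
Connected G = ∀ u v → Reach G u v

N : (G : Graph) → Fin (n G) → Subset (n G)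
N G v = tabulate (adj G v)

degree : (G : Graph) → Fin (n G) → ℕ
degree G v = ∣ N G v ∣

MinDegreeAtLeast : Graph → ℕ → Set
MinDegreeAtLeast G k = ∀ v → k ≤ degree G v

TotalKDominating : (G : Graph) → ℕ → Subset (n G) → Set
TotalKDominating G k S = ∀ v → k ≤ ∣ N G v ∩ S ∣

-- U, W form a total k-coalition (disjointness is imposed separately by the partition)
TotalKCoalition : (G : Graph) → ℕ → Subset (n G) → Subset (n G) → Set
TotalKCoalition G k U W =
  ¬ TotalKDominating G k U × ¬ TotalKDominating G k W × TotalKDominating G k (U ∪ W)

classOf : (G : Graph) {m : ℕ} → (Fin (n G) → Fin m) → Fin m → Subset (n G)
classOf G f i = tabulate (λ v → ⌊ f v ≟ i ⌋)

record TotalKCoalitionPartition (G : Graph) (k : ℕ) : Set where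
  field
    m         : ℕ
    part      : Fin (n G) → Fin m
    part-surj : ∀ i → ∃[ v ] part v ≡ i
    coalition : ∀ i → ∃[ j ] (j ≢ i × TotalKCoalition G k (classOf G part i) (classOf G part j))

-- Start from the partition of V(G) into singletons: since k ≥ 1 and no vertex
-- is its own neighbour, no class is total k-dominating.  As long as some class
-- V_i has no partner (no V_j with V_i ∪ V_j total k-dominating), merge V_i
-- with an arbitrary other class; the merged class is again not total
-- k-dominating, so the invariant is kept while the number of classes drops.
-- The process cannot reach a single class, because V(G) itself is total
-- k-dominating when δ(G) ≥ k; hence it stops at a total k-coalition
-- partition.
module Submission where

open import Defs hiding (sym)
open import Data.Nat using (ℕ; zero; suc; _≤_; _≤?_; s≤s)
open import Data.Nat.Properties using (≤-trans)
open import Data.Bool using (Bool; true)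
open import Data.Fin using (Fin; zero; _≟_; punchIn; punchOut)
open import Data.Fin.Properties
  using (punchInᵢ≢i; punchOut-cong; punchOut-punchIn; punchOut-injective; all?; any?; ¬∀⟶∃¬)
open import Data.Fin.Subset using (Subset; ∣_∣; _∩_; _∪_; _∈_; _⊆_; ⊤; Empty)
open import Data.Fin.Subset.Properties
  using (p⊆q⇒∣p∣≤∣q∣; x∈p∩q⁺; x∈p∩q⁻; x∈p∪q⁺; ∈⊤; Empty-unique; ∣⊥∣≡0)
open import Data.Vec using (tabulate)
open import Data.Vec.Properties using (lookup∘tabulate; []=⇒lookup; lookup⇒[]=)
open import Data.Product using (_×_; _,_; ∃-syntax)
open import Data.Sum using (_⊎_; inj₁; inj₂; [_,_]′)
open import Function using (_∘_)
open import Relation.Nullary using (¬_; Dec; yes; no; ¬?; _×-dec_; contradiction)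
open import Relation.Nullary.Decidable using (isYes≗does; dec-true)
open import Relation.Binary.PropositionalEquality
  using (_≡_; _≢_; refl; sym; trans; cong; subst)

∈-tabulate⁻ : ∀ {m} {p : Fin m → Bool} {v} → v ∈ tabulate p → p v ≡ true
∈-tabulate⁻ {p = p} {v} v∈ = trans (sym (lookup∘tabulate p v)) ([]=⇒lookup v∈)

∈-tabulate⁺ : ∀ {m} {p : Fin m → Bool} {v} → p v ≡ true → v ∈ tabulate p
∈-tabulate⁺ {p = p} {v} pv = lookup⇒[]= v (tabulate p) (trans (lookup∘tabulate p v) pv)

module _ (G : Graph) where

  ∈-classOf⁻ : ∀ {m} {f : Fin (n G) → Fin m} {i v} → v ∈ classOf G f i → f v ≡ i
  ∈-classOf⁻ {f = f} {i} {v} v∈ with f v ≟ i | ∈-tabulate⁻ v∈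
  ... | yes fv≡i | _  = fv≡i
  ... | no _     | ()

  ∈-classOf⁺ : ∀ {m} {f : Fin (n G) → Fin m} {i v} → f v ≡ i → v ∈ classOf G f i
  ∈-classOf⁺ {f = f} {i} {v} fv≡i =
    ∈-tabulate⁺ (trans (isYes≗does (f v ≟ i)) (dec-true (f v ≟ i) fv≡i))

  ∉-N-self : ∀ {u v} → v ≡ u → ¬ (v ∈ N G u)
  ∉-N-self {u} refl v∈N = contradiction (trans (sym (∈-tabulate⁻ v∈N)) (irr G u)) λ ()

module _ (G : Graph) (k : ℕ) where

  totalKDominating? : (S : Subset (n G)) → Dec (TotalKDominating G k S)
  totalKDominating? S = all? (λ v → k ≤? ∣ N G v ∩ S ∣)

  totalKDominating-mono : ∀ {S T} → S ⊆ T → TotalKDominating G k S → TotalKDominating G k T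
  totalKDominating-mono S⊆T dom v = ≤-trans (dom v) (p⊆q⇒∣p∣≤∣q∣ N∩S⊆N∩T)
    where
    N∩S⊆N∩T : N G v ∩ _ ⊆ N G v ∩ _
    N∩S⊆N∩T x∈ with x∈p∩q⁻ (N G v) _ x∈
    ... | x∈N , x∈S = x∈p∩q⁺ (x∈N , S⊆T x∈S)

  minDegree⇒⊤-totalKDominating : MinDegreeAtLeast G k → TotalKDominating G k ⊤
  minDegree⇒⊤-totalKDominating δ≥k v =
    ≤-trans (δ≥k v) (p⊆q⇒∣p∣≤∣q∣ {q = N G v ∩ ⊤} (λ x∈N → x∈p∩q⁺ (x∈N , ∈⊤)))

N∩-empty⇒¬totalKDominating : ∀ G k {S v} → Empty (N G v ∩ S) → ¬ TotalKDominating G (suc k) S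
N∩-empty⇒¬totalKDominating G k {S} {v} empty dom
  with subst (suc k ≤_) (trans (cong ∣_∣ (Empty-unique empty)) (∣⊥∣≡0 (n G))) (dom v)
... | ()

-- Identifies j with i; the remaining values keep their order.
merge : ∀ {m} (i j : Fin (suc m)) → j ≢ i → Fin (suc m) → Fin m
merge i j j≢i c with c ≟ j
... | yes _  = punchOut j≢i
... | no c≢j = punchOut (c≢j ∘ sym)

module _ {m} {i j : Fin (suc m)} (j≢i : j ≢ i) where

  merge-punchIn : ∀ x → merge i j j≢i (punchIn j x) ≡ x
  merge-punchIn x with punchIn j x ≟ j
  ... | yes eq = contradiction eq (punchInᵢ≢i j x)
  ... | no _   = trans (punchOut-cong j refl) (punchOut-punchIn j)

  merge-fiber : ∀ {c c′} → c ≢ j → merge i j j≢i c′ ≡ merge i j j≢i c →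
                c′ ≡ c ⊎ (c′ ≡ j × c ≡ i)
  merge-fiber {c} {c′} c≢j eq with c′ ≟ j | c ≟ j
  ... | _        | yes c≡j = contradiction c≡j c≢j
  ... | yes c′≡j | no c≢j′ = inj₂ (c′≡j , sym (punchOut-injective j≢i (c≢j′ ∘ sym) eq))
  ... | no c′≢j  | no c≢j′ = inj₁ (punchOut-injective (c′≢j ∘ sym) (c≢j′ ∘ sym) eq)

record NondominatingPartition (G : Graph) (k m : ℕ) : Set where
  field
    part          : Fin (n G) → Fin m
    part-surj     : ∀ i → ∃[ v ] part v ≡ i
    nondominating : ∀ i → ¬ TotalKDominating G k (classOf G part i)

module _ {G : Graph} {k : ℕ} where

  open NondominatingPartition

  HasPartner : ∀ {m} → NondominatingPartition G k m → Fin m → Set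
  HasPartner P i =
    ∃[ j ] (j ≢ i × TotalKDominating G k (classOf G (part P) i ∪ classOf G (part P) j))

  hasPartner? : ∀ {m} (P : NondominatingPartition G k m) i → Dec (HasPartner P i)
  hasPartner? P i = any? λ j →
    ¬? (j ≟ i) ×-dec totalKDominating? G k (classOf G (part P) i ∪ classOf G (part P) j)

  singletonPartition : 1 ≤ k → NondominatingPartition G k (n G)
  singletonPartition (s≤s _) = record
    { part          = λ v → v
    ; part-surj     = λ u → u , refl
    ; nondominating = λ u → N∩-empty⇒¬totalKDominating G _ {v = u} λ (v , v∈) →
        let v∈N , v∈u = x∈p∩q⁻ (N G u) _ v∈ in ∉-N-self G (∈-classOf⁻ G v∈u) v∈N
    }

  ¬singleClass : MinDegreeAtLeast G k → ¬ NondominatingPartition G k 1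
  ¬singleClass δ≥k P = nondominating P zero
    (totalKDominating-mono G k (λ _ → ∈-classOf⁺ G (Fin1≡zero (part P _)))
      (minDegree⇒⊤-totalKDominating G k δ≥k))
    where
    Fin1≡zero : (x : Fin 1) → x ≡ zero
    Fin1≡zero zero = refl

  mergePartition : ∀ {m} (P : NondominatingPartition G k (suc m)) {i j} (j≢i : j ≢ i) →
                   ¬ HasPartner P i → NondominatingPartition G k m
  mergePartition P {i} {j} j≢i noPartner = record
    { part          = merge i j j≢i ∘ part P
    ; part-surj     = surj
    ; nondominating = nondom
    }
    where
    surj : ∀ x → ∃[ v ] merge i j j≢i (part P v) ≡ x
    surj x with part-surj P (punchIn j x)
    ... | v , eq = v , trans (cong (merge i j j≢i) eq) (merge-punchIn j≢i x)

    fiber : ∀ x {v} → v ∈ classOf G (merge i j j≢i ∘ part P) x →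
            part P v ≡ punchIn j x ⊎ (part P v ≡ j × punchIn j x ≡ i)
    fiber x v∈ = merge-fiber j≢i (punchInᵢ≢i j x)
      (trans (∈-classOf⁻ G v∈) (sym (merge-punchIn j≢i x)))

    nondom : ∀ x → ¬ TotalKDominating G k (classOf G (merge i j j≢i ∘ part P) x)
    nondom x dom with punchIn j x ≟ i
    ... | yes c≡i = noPartner (j , j≢i , totalKDominating-mono G k ⊆i∪j dom)
      where
      ⊆i∪j : classOf G _ x ⊆ classOf G (part P) i ∪ classOf G (part P) j
      ⊆i∪j v∈ with fiber x v∈
      ... | inj₁ eq       = x∈p∪q⁺ (inj₁ (∈-classOf⁺ G (trans eq c≡i)))
      ... | inj₂ (eq , _) = x∈p∪q⁺ (inj₂ (∈-classOf⁺ G eq))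
    ... | no c≢i = nondominating P (punchIn j x) (totalKDominating-mono G k ⊆c dom)
      where
      ⊆c : classOf G _ x ⊆ classOf G (part P) (punchIn j x)
      ⊆c v∈ with fiber x v∈
      ... | inj₁ eq        = ∈-classOf⁺ G eq
      ... | inj₂ (_ , c≡i) = contradiction c≡i c≢i

  toCoalitionPartition : ∀ {m} (P : NondominatingPartition G k m) →
                         (∀ i → HasPartner P i) → TotalKCoalitionPartition G k
  toCoalitionPartition {m} P partner = record
    { m         = m
    ; part      = part P
    ; part-surj = part-surj P
    ; coalition = λ i → let j , j≢i , dom = partner i in
        j , j≢i , nondominating P i , nondominating P j , dom
    }

  partnersOrCoarsening : ∀ {m} (P : NondominatingPartition G k (suc (suc m))) →
                         (∀ i → HasPartner P i) ⊎ NondominatingPartition G k (suc m)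
  partnersOrCoarsening P with all? (hasPartner? P)
  ... | yes partner = inj₁ partner
  ... | no ¬partner =
    let i , noPartner = ¬∀⟶∃¬ _ _ (hasPartner? P) ¬partner in
    -- punchIn i zero is merely some class other than i.
    inj₂ (mergePartition P (punchInᵢ≢i i zero) noPartner)

  coalitionPartition : MinDegreeAtLeast G k → ∀ m → NondominatingPartition G k m →
                       TotalKCoalitionPartition G k
  coalitionPartition _   zero          P = toCoalitionPartition P λ ()
  coalitionPartition δ≥k (suc zero)    P = contradiction P (¬singleClass δ≥k)
  coalitionPartition δ≥k (suc (suc m)) P =
    [ toCoalitionPartition P , coalitionPartition δ≥k (suc m) ]′ (partnersOrCoarsening P)

proposition2p1 : (k : ℕ) → 1 ≤ k → (G : Graph) → Connected G →
    MinDegreeAtLeast G k → TotalKCoalitionPartition G k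
proposition2p1 k k≥1 G _ δ≥k = coalitionPartition δ≥k (n G) (singletonPartition k≥1)
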